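{- Let $L$ be a BL-algebra and $\mathbf{a},\mathbf{b},\mathbf{c}$ good sequences in $L$. Then $$(\mathbf{a}\vee\mathbf{b})+\mathbf{c}=(\mathbf{a}+\mathbf{c})\vee(\mathbf{b}+\mathbf{c})\quad\text{and}\quad(\mathbf{a}\wedge\mathbf{b})+\mathbf{c}=(\mathbf{a}+\mathbf{c})\wedge(\mathbf{b}+\mathbf{c}).$$
   Context: A BL-algebra is an algebra $(L,\wedge,\vee,\otimes,\to,0,1)$ such that $(L,\wedge,\vee,0,1)$ is a bounded lattice, $(L,\otimes,1)$ is a commutative monoid, $x\otimes y\le z$ iff $x\le y\to z$, $x\wedge y=x\otimes(x\to y)$, and $(x\to y)\vee(y\to x)=1$. Put $\bar x=x\to0$, $x\oslash y=\bar x\to y$, $x+y=(x\oslash y)\wedge(y\oslash x)$. A good sequence is a sequence $(a_1,a_2,\ldots)$ in $L$ with $a_i+a_{i+1}=a_i$ for all $i$ and $a_r=0$ for large $r$. Sum of sequences: $(\mathbf{a}+\mathbf{b})_i=a_i+(a_{i-1}\otimes b_1)+\cdots+(a_1\otimes b_{i-1})+b_i$ (a good sequence when $\mathbf{a},\mathbf{b}$ are). Joins and meets of good sequences are taken componentwise: $(\mathbf{a}\vee\mathbf{b})_i=a_i\vee b_i$, $(\mathbf{a}\wedge\mathbf{b})_i=a_i\wedge b_i$ (these are good sequences). -}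

module Defs where

open import Level using (Level; suc; _⊔_)
open import Data.Nat as ℕ using (ℕ; zero) renaming (suc to 1+)
open import Data.Product using (Σ; _×_; ∃)
open import Relation.Binary.PropositionalEquality using (_≡_)

record BLAlgebra (ℓ : Level) : Set (suc ℓ) where
  infixr 7 _∧_
  infixr 6 _∨_
  infixr 8 _⊗_
  infixr 5 _⇒_
  field
    Carrier : Set ℓ
    _∧_ _∨_ _⊗_ _⇒_ : Carrier → Carrier → Carrier
    𝟘 𝟙 : Carrier
    ∧-comm  : ∀ x y → x ∧ y ≡ y ∧ x
    ∨-comm  : ∀ x y → x ∨ y ≡ y ∨ x
    ∧-assoc : ∀ x y z → (x ∧ y) ∧ z ≡ x ∧ (y ∧ z)
    ∨-assoc : ∀ x y z → (x ∨ y) ∨ z ≡ x ∨ (y ∨ z)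
    ∧-absorbs-∨ : ∀ x y → x ∧ (x ∨ y) ≡ x
    ∨-absorbs-∧ : ∀ x y → x ∨ (x ∧ y) ≡ x
    ∧-𝟘 : ∀ x → 𝟘 ∧ x ≡ 𝟘
    ∧-𝟙 : ∀ x → x ∧ 𝟙 ≡ x
    ⊗-comm  : ∀ x y → x ⊗ y ≡ y ⊗ x
    ⊗-assoc : ∀ x y z → (x ⊗ y) ⊗ z ≡ x ⊗ (y ⊗ z)
    ⊗-identityʳ : ∀ x → x ⊗ 𝟙 ≡ x
    residuation→ : ∀ x y z → (x ⊗ y) ∧ z ≡ x ⊗ y → x ∧ (y ⇒ z) ≡ x
    residuation← : ∀ x y z → x ∧ (y ⇒ z) ≡ x → (x ⊗ y) ∧ z ≡ x ⊗ y
    divisibility : ∀ x y → x ∧ y ≡ x ⊗ (x ⇒ y)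
    prelinearity : ∀ x y → (x ⇒ y) ∨ (y ⇒ x) ≡ 𝟙

  _≤_ : Carrier → Carrier → Set ℓ
  x ≤ y = x ∧ y ≡ x

  ¬_ : Carrier → Carrier
  ¬ x = x ⇒ 𝟘

  _⊘_ : Carrier → Carrier → Carrier
  x ⊘ y = (¬ x) ⇒ y

  _⊕_ : Carrier → Carrier → Carrier
  x ⊕ y = (x ⊘ y) ∧ (y ⊘ x)
  infixl 5 _⊕_

  -- Sequences (a₁, a₂, …) are represented 0-based: a : ℕ → Carrier with
  -- a 0 = a₁, a 1 = a₂, …
  Seq : Set ℓ
  Seq = ℕ → Carrier

  record IsGood (a : Seq) : Set ℓ where
    field
      good     : ∀ i → a i ⊕ a (1+ i) ≡ a i
      eventually-zero : ∃ λ r → ∀ i → r ℕ.≤ i → a i ≡ 𝟘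

  -- sumSeq a b n = a_n + (a_{n-1} ⊗ b_0) + ⋯ + (a_0 ⊗ b_{n-1}) + b_n
  -- (0-based; parenthesised from the left).
  -- go a b j k acc : acc + (a_j ⊗ b_k) + (a_{j-1} ⊗ b_{k+1}) + … + (a_0 ⊗ b_{k+j})
  go : Seq → Seq → ℕ → ℕ → Carrier → Carrier
  go a b zero     k acc = acc ⊕ (a 0 ⊗ b k)
  go a b (1+ j)   k acc = go a b j (1+ k) (acc ⊕ (a (1+ j) ⊗ b k))

  _+ˢ_ : Seq → Seq → Seq
  (a +ˢ b) zero   = a 0 ⊕ b 0
  (a +ˢ b) (1+ n) = go a b n 0 (a (1+ n)) ⊕ b (1+ n)

  _∨ˢ_ : Seq → Seq → Seq
  (a ∨ˢ b) i = a i ∨ b i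

  _∧ˢ_ : Seq → Seq → Seq
  (a ∧ˢ b) i = a i ∧ b i

module Submission where

-- Call sequences a, b *comparable* if there are u, v with 1 ≤ u ∨ v,
-- u ⊗ aⱼ ≤ bⱼ and v ⊗ bⱼ ≤ aⱼ for all j (in a BL-chain: a ≤ b or b ≤ a).
-- Since ⊗ distributes sub-additively over ⊕, the sum of sequences can be
-- scaled: if w ⊗ xⱼ ≤ yⱼ for all j then wⁱ⁺¹ ⊗ (x + c)ᵢ ≤ (y + c)ᵢ; with
-- w = 1 this is monotonicity, which gives the easy halves of both identities.
-- For the other halves we split along the partition of unity 1 ≤ uⁿ ∨ vⁿ
-- and scale by u resp. v.  So comparable sequences satisfy the proposition
-- for every c.  Finally good sequences are comparable: a good pair
-- x ⊕ y = x satisfies y ≤ x and 1 ≤ x ∨ ¬y (via Glivenko's identity and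
-- De Morgan), which gives 1 ≤ (aⱼ → bⱼ) ∨ (bₖ → aₖ) for all j, k; u and v
-- are then the finite meets of the aⱼ → bⱼ resp. bⱼ → aⱼ over the indices
-- below the point where both sequences vanish.

open import Defs
open import Level using (Level)
open import Data.Nat as ℕ using (ℕ; zero; suc)
import Data.Nat.Properties as ℕP
open import Data.Product using (_×_; _,_; proj₁; proj₂)
open import Relation.Binary.PropositionalEquality
  using (_≡_; refl; sym; trans; cong; subst; isEquivalence; module ≡-Reasoning)
open import Relation.Binary.Bundles using (Poset)
open import Relation.Binary.Definitions using (tri<; tri≈; tri>)
open import Relation.Nullary using (yes; no)
import Relation.Binary.Reasoning.PartialOrder as PosetReasoning

module BLTheory {ℓ : Level} (L : BLAlgebra ℓ) where
  open BLAlgebra L hiding (_≤_)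

  -- The lattice order x ≤ y ⇔ x ∧ y = x of the algebra, with the usual
  -- (low) precedence so that x ⊗ y ≤ z ⇒ w needs no parentheses.
  infix 4 _≤_
  _≤_ : Carrier → Carrier → Set ℓ
  _≤_ = BLAlgebra._≤_ L

  ∧-idem : ∀ x → x ∧ x ≡ x
  ∧-idem x = trans (cong (x ∧_) (sym (∨-absorbs-∧ x x))) (∧-absorbs-∨ x (x ∧ x))

  ≤-reflexive : ∀ {x y} → x ≡ y → x ≤ y
  ≤-reflexive {x} refl = ∧-idem x

  ≤-refl : ∀ {x} → x ≤ x
  ≤-refl = ≤-reflexive refl

  ≤-trans : ∀ {x y z} → x ≤ y → y ≤ z → x ≤ z
  ≤-trans {x} {y} {z} x≤y y≤z = begin
    x ∧ z        ≡⟨ cong (_∧ z) (sym x≤y) ⟩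
    (x ∧ y) ∧ z  ≡⟨ ∧-assoc x y z ⟩
    x ∧ (y ∧ z)  ≡⟨ cong (x ∧_) y≤z ⟩
    x ∧ y        ≡⟨ x≤y ⟩
    x            ∎
    where open ≡-Reasoning

  ≤-antisym : ∀ {x y} → x ≤ y → y ≤ x → x ≡ y
  ≤-antisym {x} {y} x≤y y≤x = trans (sym x≤y) (trans (∧-comm x y) y≤x)

  ≤-poset : Poset ℓ ℓ ℓ
  ≤-poset = record
    { Carrier = Carrier
    ; _≈_ = _≡_
    ; _≤_ = _≤_
    ; isPartialOrder = record
      { isPreorder = record
        { isEquivalence = isEquivalence ; reflexive = ≤-reflexive ; trans = ≤-trans }
      ; antisym = ≤-antisym
      }
    }

  open PosetReasoning ≤-poset using (begin_; step-≤; step-≡-⟩; _∎)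

  x∧y≤x : ∀ {x y} → x ∧ y ≤ x
  x∧y≤x {x} {y} = trans (∧-assoc x y x) (trans (cong (x ∧_) (∧-comm y x))
    (trans (sym (∧-assoc x x y)) (cong (_∧ y) (∧-idem x))))

  x∧y≤y : ∀ {x y} → x ∧ y ≤ y
  x∧y≤y {x} {y} = trans (∧-assoc x y y) (cong (x ∧_) (∧-idem y))

  ∧-glb : ∀ {x y z} → z ≤ x → z ≤ y → z ≤ x ∧ y
  ∧-glb {x} {y} {z} z≤x z≤y = trans (sym (∧-assoc z x y)) (trans (cong (_∧ y) z≤x) z≤y)

  ∧-mono : ∀ {x x′ y y′} → x ≤ x′ → y ≤ y′ → x ∧ y ≤ x′ ∧ y′
  ∧-mono p q = ∧-glb (≤-trans x∧y≤x p) (≤-trans x∧y≤y q)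

  x≤x∨y : ∀ {x y} → x ≤ x ∨ y
  x≤x∨y {x} {y} = ∧-absorbs-∨ x y

  y≤x∨y : ∀ {x y} → y ≤ x ∨ y
  y≤x∨y {x} {y} = ≤-trans x≤x∨y (≤-reflexive (∨-comm y x))

  ∨-lub : ∀ {x y z} → x ≤ z → y ≤ z → x ∨ y ≤ z
  ∨-lub {x} {y} {z} x≤z y≤z =
    trans (cong ((x ∨ y) ∧_) (sym x∨y∨z≡z)) (∧-absorbs-∨ (x ∨ y) z)
    where
    joinʳ : ∀ {p q} → p ≤ q → p ∨ q ≡ q
    joinʳ {p} {q} p≤q = trans (cong (_∨ q) (sym p≤q)) (trans (∨-comm (p ∧ q) q)
                          (trans (cong (q ∨_) (∧-comm p q)) (∨-absorbs-∧ q p)))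
    x∨y∨z≡z : (x ∨ y) ∨ z ≡ z
    x∨y∨z≡z = trans (∨-assoc x y z) (trans (cong (x ∨_) (joinʳ y≤z)) (joinʳ x≤z))

  ∨-mono : ∀ {x x′ y y′} → x ≤ x′ → y ≤ y′ → x ∨ y ≤ x′ ∨ y′
  ∨-mono p q = ∨-lub (≤-trans p x≤x∨y) (≤-trans q y≤x∨y)

  𝟘-least : ∀ {x} → 𝟘 ≤ x
  𝟘-least {x} = ∧-𝟘 x

  𝟙-greatest : ∀ {x} → x ≤ 𝟙
  𝟙-greatest {x} = ∧-𝟙 x

  ⊗-identityˡ : ∀ x → 𝟙 ⊗ x ≡ x
  ⊗-identityˡ x = trans (⊗-comm 𝟙 x) (⊗-identityʳ x)

  ⊗-leftComm : ∀ x y z → x ⊗ (y ⊗ z) ≡ y ⊗ (x ⊗ z)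
  ⊗-leftComm x y z =
    trans (sym (⊗-assoc x y z)) (trans (cong (_⊗ z) (⊗-comm x y)) (⊗-assoc y x z))

  ⊗-rightComm : ∀ x y z → (x ⊗ y) ⊗ z ≡ (x ⊗ z) ⊗ y
  ⊗-rightComm x y z =
    trans (⊗-assoc x y z) (trans (cong (x ⊗_) (⊗-comm y z)) (sym (⊗-assoc x z y)))

  ⊗-rotate : ∀ x y z → (x ⊗ y) ⊗ z ≡ y ⊗ (x ⊗ z)
  ⊗-rotate x y z = trans (⊗-assoc x y z) (⊗-leftComm x y z)

  ⊗-flip : ∀ {x y z} → x ⊗ y ≤ z → y ⊗ x ≤ z
  ⊗-flip {x} {y} = ≤-trans (≤-reflexive (⊗-comm y x))

  curry : ∀ {x y z} → x ⊗ y ≤ z → x ≤ y ⇒ z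
  curry {x} {y} {z} = residuation→ x y z

  uncurry : ∀ {x y z} → x ≤ y ⇒ z → x ⊗ y ≤ z
  uncurry {x} {y} {z} = residuation← x y z

  modus-ponens : ∀ {y z} → (y ⇒ z) ⊗ y ≤ z
  modus-ponens = uncurry ≤-refl

  modus-ponens′ : ∀ {y z} → y ⊗ (y ⇒ z) ≤ z
  modus-ponens′ = ⊗-flip modus-ponens

  ⇒⊗≡∧ : ∀ x y → (x ⇒ y) ⊗ x ≡ x ∧ y
  ⇒⊗≡∧ x y = trans (⊗-comm (x ⇒ y) x) (sym (divisibility x y))

  ≤⇒factor : ∀ {x y} → x ≤ y → x ≡ y ⊗ (y ⇒ x)
  ≤⇒factor {x} {y} x≤y = trans (sym x≤y) (trans (∧-comm x y) (divisibility y x))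

  ⊗-monoˡ : ∀ {x x′ y} → x ≤ x′ → x ⊗ y ≤ x′ ⊗ y
  ⊗-monoˡ x≤x′ = uncurry (≤-trans x≤x′ (curry ≤-refl))

  ⊗-monoʳ : ∀ {x y y′} → y ≤ y′ → x ⊗ y ≤ x ⊗ y′
  ⊗-monoʳ {x} {y} {y′} y≤y′ = ⊗-flip (≤-trans (⊗-monoˡ y≤y′) (≤-reflexive (⊗-comm y′ x)))

  ⊗-mono : ∀ {x x′ y y′} → x ≤ x′ → y ≤ y′ → x ⊗ y ≤ x′ ⊗ y′
  ⊗-mono p q = ≤-trans (⊗-monoˡ p) (⊗-monoʳ q)

  x⊗y≤x : ∀ {x y} → x ⊗ y ≤ x
  x⊗y≤x {x} = ≤-trans (⊗-monoʳ 𝟙-greatest) (≤-reflexive (⊗-identityʳ x))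

  x⊗y≤y : ∀ {x y} → x ⊗ y ≤ y
  x⊗y≤y = ⊗-flip x⊗y≤x

  ⊗≤∧ : ∀ {x y} → x ⊗ y ≤ x ∧ y
  ⊗≤∧ = ∧-glb x⊗y≤x x⊗y≤y

  ⇒-monoʳ : ∀ {x y y′} → y ≤ y′ → x ⇒ y ≤ x ⇒ y′
  ⇒-monoʳ y≤y′ = curry (≤-trans modus-ponens y≤y′)

  ⇒-antitoneˡ : ∀ {x x′ y} → x′ ≤ x → x ⇒ y ≤ x′ ⇒ y
  ⇒-antitoneˡ x′≤x = curry (≤-trans (⊗-monoʳ x′≤x) modus-ponens)

  y≤x⇒y : ∀ {x y} → y ≤ x ⇒ y
  y≤x⇒y = curry x⊗y≤x

  ∨-⊗-bounded : ∀ {p q z r} → p ⊗ z ≤ r → q ⊗ z ≤ r → (p ∨ q) ⊗ z ≤ r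
  ∨-⊗-bounded p⊗z≤r q⊗z≤r = uncurry (∨-lub (curry p⊗z≤r) (curry q⊗z≤r))

  ⊗-∨-bounded : ∀ {w p q r} → w ⊗ p ≤ r → w ⊗ q ≤ r → w ⊗ (p ∨ q) ≤ r
  ⊗-∨-bounded w⊗p≤r w⊗q≤r = ⊗-flip (∨-⊗-bounded (⊗-flip w⊗p≤r) (⊗-flip w⊗q≤r))

  by-cases : ∀ {p q z r} → 𝟙 ≤ p ∨ q → p ⊗ z ≤ r → q ⊗ z ≤ r → z ≤ r
  by-cases {p} {q} {z} {r} 𝟙≤p∨q p⊗z≤r q⊗z≤r = begin
    z            ≡⟨ sym (⊗-identityˡ z) ⟩
    𝟙 ⊗ z        ≤⟨ ⊗-monoˡ 𝟙≤p∨q ⟩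
    (p ∨ q) ⊗ z  ≤⟨ ∨-⊗-bounded p⊗z≤r q⊗z≤r ⟩
    r            ∎

  prelinear : ∀ x y → 𝟙 ≤ (x ⇒ y) ∨ (y ⇒ x)
  prelinear x y = ≤-reflexive (sym (prelinearity x y))

  unity-comm : ∀ {p q} → 𝟙 ≤ p ∨ q → 𝟙 ≤ q ∨ p
  unity-comm {p} {q} 𝟙≤p∨q = ≤-trans 𝟙≤p∨q (≤-reflexive (∨-comm p q))

  x≤¬¬x : ∀ {x} → x ≤ ¬ ¬ x
  x≤¬¬x = curry modus-ponens′

  ¬-antitone : ∀ {x y} → x ≤ y → ¬ y ≤ ¬ x
  ¬-antitone = ⇒-antitoneˡ

  ¬¬¬x≤¬x : ∀ {x} → ¬ ¬ ¬ x ≤ ¬ x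
  ¬¬¬x≤¬x = ¬-antitone x≤¬¬x

  ¬x≤x⇒y : ∀ {x y} → ¬ x ≤ x ⇒ y
  ¬x≤x⇒y = ⇒-monoʳ 𝟘-least

  ≤𝟘⇒𝟙≤¬ : ∀ {z} → z ≤ 𝟘 → 𝟙 ≤ ¬ z
  ≤𝟘⇒𝟙≤¬ z≤𝟘 = curry (≤-trans x⊗y≤y z≤𝟘)

  ≡𝟘⇒top : ∀ {x y} → x ≡ 𝟘 → 𝟙 ≤ x ⇒ y
  ≡𝟘⇒top x≡𝟘 = curry (≤-trans x⊗y≤y (≤-trans (≤-reflexive x≡𝟘) 𝟘-least))

  ⇒¬-swap : ∀ {x y} → x ⇒ ¬ y ≤ y ⇒ ¬ x
  ⇒¬-swap {x} {y} = curry (curry (begin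
    ((x ⇒ ¬ y) ⊗ y) ⊗ x  ≡⟨ ⊗-rightComm (x ⇒ ¬ y) y x ⟩
    ((x ⇒ ¬ y) ⊗ x) ⊗ y  ≤⟨ ⊗-monoˡ modus-ponens ⟩
    ¬ y ⊗ y              ≤⟨ modus-ponens ⟩
    𝟘                    ∎))

  -- The nontrivial half of Glivenko's identity ¬¬(p ⇒ q) = ¬¬p ⇒ ¬¬q;
  -- it needs prelinearity (case split on q ⇒ p) and divisibility.
  glivenko : ∀ p q → ¬ ¬ p ⇒ ¬ ¬ q ≤ ¬ ¬ (p ⇒ q)
  glivenko p q = by-cases (prelinear p q) (≤-trans x⊗y≤x x≤¬¬x) (curry d⊗g⊗¬e≤𝟘)
    where
    g e d h : Carrier
    g = ¬ ¬ p ⇒ ¬ ¬ q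
    e = p ⇒ q
    d = q ⇒ p
    h = ¬ ¬ p ⇒ ¬ e
    -- ¬e lies below ¬¬p, hence is a multiple of it
    ¬e≡¬¬p⊗h : ¬ e ≡ ¬ ¬ p ⊗ h
    ¬e≡¬¬p⊗h = ≤⇒factor (¬-antitone ¬x≤x⇒y)
    d⊗h≤¬q : d ⊗ h ≤ ¬ q
    d⊗h≤¬q = curry (begin
      (d ⊗ h) ⊗ q        ≡⟨ ⊗-rotate d h q ⟩
      h ⊗ (d ⊗ q)        ≤⟨ ⊗-monoʳ (∧-glb modus-ponens x⊗y≤y) ⟩
      h ⊗ (p ∧ q)        ≡⟨ cong (h ⊗_) (divisibility p q) ⟩
      h ⊗ (p ⊗ e)        ≤⟨ ⊗-monoʳ (⊗-monoˡ x≤¬¬x) ⟩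
      h ⊗ (¬ ¬ p ⊗ e)    ≡⟨ sym (⊗-assoc h (¬ ¬ p) e) ⟩
      (h ⊗ ¬ ¬ p) ⊗ e    ≤⟨ ⊗-monoˡ modus-ponens ⟩
      ¬ e ⊗ e            ≤⟨ modus-ponens ⟩
      𝟘                  ∎)
    d⊗g⊗¬e≤𝟘 : (d ⊗ g) ⊗ ¬ e ≤ 𝟘
    d⊗g⊗¬e≤𝟘 = begin
      (d ⊗ g) ⊗ ¬ e            ≡⟨ ⊗-rotate d g (¬ e) ⟩
      g ⊗ (d ⊗ ¬ e)            ≡⟨ cong (λ z → g ⊗ (d ⊗ z)) ¬e≡¬¬p⊗h ⟩
      g ⊗ (d ⊗ (¬ ¬ p ⊗ h))    ≡⟨ cong (g ⊗_) (⊗-leftComm d (¬ ¬ p) h) ⟩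
      g ⊗ (¬ ¬ p ⊗ (d ⊗ h))    ≤⟨ ⊗-monoʳ (⊗-monoʳ d⊗h≤¬q) ⟩
      g ⊗ (¬ ¬ p ⊗ ¬ q)        ≡⟨ sym (⊗-assoc g (¬ ¬ p) (¬ q)) ⟩
      (g ⊗ ¬ ¬ p) ⊗ ¬ q        ≤⟨ ⊗-monoˡ modus-ponens ⟩
      ¬ ¬ q ⊗ ¬ q              ≤⟨ modus-ponens ⟩
      𝟘                        ∎

  -- De Morgan's law for ¬ over ∧ (the converse holds in any residuated lattice).
  de-morgan : ∀ p q → ¬ (p ∧ q) ≤ ¬ p ∨ ¬ q
  de-morgan p q = by-cases (prelinear p q)
    (≤-trans (curry (kills (⇒⊗≡∧ p q))) x≤x∨y)
    (≤-trans (curry (kills (trans (⇒⊗≡∧ q p) (∧-comm q p)))) y≤x∨y)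
    where
    kills : ∀ {r s} → r ⊗ s ≡ p ∧ q → (r ⊗ ¬ (p ∧ q)) ⊗ s ≤ 𝟘
    kills {r} {s} r⊗s≡p∧q = begin
      (r ⊗ ¬ (p ∧ q)) ⊗ s  ≡⟨ ⊗-rotate r (¬ (p ∧ q)) s ⟩
      ¬ (p ∧ q) ⊗ (r ⊗ s)  ≡⟨ cong (¬ (p ∧ q) ⊗_) r⊗s≡p∧q ⟩
      ¬ (p ∧ q) ⊗ (p ∧ q)  ≤⟨ modus-ponens ⟩
      𝟘                    ∎

  -- Good pairs: x ⊕ y = x, where x ⊕ y = (¬x ⇒ y) ∧ (¬y ⇒ x)

  y≤x⊕y : ∀ {x y} → y ≤ x ⊕ y
  y≤x⊕y = ∧-glb y≤x⇒y (curry (≤-trans modus-ponens′ 𝟘-least))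

  module GoodPair {x y : Carrier} (x⊕y≡x : x ⊕ y ≡ x) where

    y≤x : y ≤ x
    y≤x = subst (y ≤_) x⊕y≡x y≤x⊕y

    private
      s t : Carrier
      s = ¬ y ⇒ x
      t = ¬ x ⇒ y

      -- Here x = x ⊕ y = t ∧ s, and ¬x ∧ y = ¬x ⊗ t by divisibility.
      x≤t : x ≤ t
      x≤t = ≤-trans (≤-reflexive (sym x⊕y≡x)) x∧y≤x

      t⇒s-kills : (t ⇒ s) ⊗ (¬ x ∧ y) ≤ 𝟘
      t⇒s-kills = begin
        (t ⇒ s) ⊗ (¬ x ∧ y)    ≡⟨ cong ((t ⇒ s) ⊗_) (divisibility (¬ x) y) ⟩
        (t ⇒ s) ⊗ (¬ x ⊗ t)    ≡⟨ ⊗-leftComm (t ⇒ s) (¬ x) t ⟩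
        ¬ x ⊗ ((t ⇒ s) ⊗ t)    ≡⟨ cong (¬ x ⊗_) (trans (⇒⊗≡∧ t s) x⊕y≡x) ⟩
        ¬ x ⊗ x                ≤⟨ modus-ponens ⟩
        𝟘                      ∎

      -- By cases on (t ⇒ s) ∨ (s ⇒ t); in the first case t ⇒ s ≤ ¬¬x ∨ ¬y
      -- by the previous fact and De Morgan, and both ¬¬x ⊗ s, ¬y ⊗ s are ≤ t.
      s≤t : s ≤ t
      s≤t = by-cases (prelinear t s) t⇒s⊗s≤t modus-ponens
        where
        t⇒s≤¬¬x∨¬y : t ⇒ s ≤ ¬ ¬ x ∨ ¬ y
        t⇒s≤¬¬x∨¬y = ≤-trans (curry t⇒s-kills) (de-morgan (¬ x) y)
        t⇒s⊗s≤t : (t ⇒ s) ⊗ s ≤ t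
        t⇒s⊗s≤t = ≤-trans (⊗-monoˡ t⇒s≤¬¬x∨¬y)
          (∨-⊗-bounded (≤-trans x⊗y≤x ¬x≤x⇒y) (≤-trans modus-ponens′ x≤t))

      s≤x : s ≤ x
      s≤x = ≤-trans (∧-glb s≤t ≤-refl) (≤-reflexive x⊕y≡x)

      -- Since t ⊗ ¬y ≤ ¬¬x, Glivenko turns s ≤ x into t ≤ ¬¬x.
      t≤¬¬x : t ≤ ¬ ¬ x
      t≤¬¬x = begin
        t                  ≤⟨ curry (curry t⊗¬y⊗¬x≤𝟘) ⟩
        ¬ y ⇒ ¬ ¬ x        ≤⟨ ⇒-antitoneˡ ¬¬¬x≤¬x ⟩
        ¬ ¬ ¬ y ⇒ ¬ ¬ x    ≤⟨ glivenko (¬ y) x ⟩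
        ¬ ¬ s              ≤⟨ ¬-antitone (¬-antitone s≤x) ⟩
        ¬ ¬ x              ∎
        where
        t⊗¬y⊗¬x≤𝟘 : (t ⊗ ¬ y) ⊗ ¬ x ≤ 𝟘
        t⊗¬y⊗¬x≤𝟘 = begin
          (t ⊗ ¬ y) ⊗ ¬ x  ≡⟨ ⊗-rightComm t (¬ y) (¬ x) ⟩
          (t ⊗ ¬ x) ⊗ ¬ y  ≤⟨ ⊗-monoˡ modus-ponens ⟩
          y ⊗ ¬ y          ≤⟨ modus-ponens′ ⟩
          𝟘                ∎

      ¬x∧y≤𝟘 : ¬ x ∧ y ≤ 𝟘
      ¬x∧y≤𝟘 = begin
        ¬ x ∧ y      ≡⟨ divisibility (¬ x) y ⟩
        ¬ x ⊗ t      ≤⟨ ⊗-monoʳ t≤¬¬x ⟩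
        ¬ x ⊗ ¬ ¬ x  ≤⟨ modus-ponens′ ⟩
        𝟘            ∎

      ¬¬x≤x∨¬y : ¬ ¬ x ≤ x ∨ ¬ y
      ¬¬x≤x∨¬y = by-cases (prelinear (¬ y) x)
        (≤-trans x⊗y≤x (≤-trans s≤x x≤x∨y))
        (≤-trans (⊗-monoˡ ⇒¬-swap) (≤-trans (curry y⇒¬x⊗¬¬x⊗y≤𝟘) y≤x∨y))
        where
        y⇒¬x⊗¬¬x⊗y≤𝟘 : ((y ⇒ ¬ x) ⊗ ¬ ¬ x) ⊗ y ≤ 𝟘
        y⇒¬x⊗¬¬x⊗y≤𝟘 = begin
          ((y ⇒ ¬ x) ⊗ ¬ ¬ x) ⊗ y  ≡⟨ ⊗-rightComm (y ⇒ ¬ x) (¬ ¬ x) y ⟩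
          ((y ⇒ ¬ x) ⊗ y) ⊗ ¬ ¬ x  ≤⟨ ⊗-monoˡ modus-ponens ⟩
          ¬ x ⊗ ¬ ¬ x              ≤⟨ modus-ponens′ ⟩
          𝟘                        ∎

    unity : 𝟙 ≤ x ∨ ¬ y
    unity = begin
      𝟙              ≤⟨ ≤𝟘⇒𝟙≤¬ ¬x∧y≤𝟘 ⟩
      ¬ (¬ x ∧ y)    ≤⟨ de-morgan (¬ x) y ⟩
      ¬ ¬ x ∨ ¬ y    ≤⟨ ∨-lub ¬¬x≤x∨¬y y≤x∨y ⟩
      x ∨ ¬ y        ∎

  ⊘-mono : ∀ {x x′ y y′} → x ≤ x′ → y ≤ y′ → x ⊘ y ≤ x′ ⊘ y′
  ⊘-mono x≤x′ y≤y′ = ≤-trans (⇒-antitoneˡ (¬-antitone x≤x′)) (⇒-monoʳ y≤y′)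

  ⊕-mono : ∀ {x x′ y y′} → x ≤ x′ → y ≤ y′ → x ⊕ y ≤ x′ ⊕ y′
  ⊕-mono p q = ∧-mono (⊘-mono p q) (⊘-mono q p)

  ⊕-comm : ∀ x y → x ⊕ y ≡ y ⊕ x
  ⊕-comm x y = ∧-comm (x ⊘ y) (y ⊘ x)

  ⊗-⊕-subdistribˡ : ∀ p s t → p ⊗ (s ⊕ t) ≤ (p ⊗ s) ⊕ t
  ⊗-⊕-subdistribˡ p s t = ∧-glb (curry first) (curry second)
    where
    p⊗¬[p⊗s]≤¬s : p ⊗ ¬ (p ⊗ s) ≤ ¬ s
    p⊗¬[p⊗s]≤¬s = curry (≤-trans (≤-reflexive (⊗-rotate p (¬ (p ⊗ s)) s)) modus-ponens)
    first : (p ⊗ (s ⊕ t)) ⊗ ¬ (p ⊗ s) ≤ t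
    first = begin
      (p ⊗ (s ⊕ t)) ⊗ ¬ (p ⊗ s)  ≡⟨ ⊗-rotate p (s ⊕ t) (¬ (p ⊗ s)) ⟩
      (s ⊕ t) ⊗ (p ⊗ ¬ (p ⊗ s))  ≤⟨ ⊗-mono x∧y≤x p⊗¬[p⊗s]≤¬s ⟩
      (¬ s ⇒ t) ⊗ ¬ s            ≤⟨ modus-ponens ⟩
      t                          ∎
    second : (p ⊗ (s ⊕ t)) ⊗ ¬ t ≤ p ⊗ s
    second = begin
      (p ⊗ (s ⊕ t)) ⊗ ¬ t  ≡⟨ ⊗-assoc p (s ⊕ t) (¬ t) ⟩
      p ⊗ ((s ⊕ t) ⊗ ¬ t)  ≤⟨ ⊗-monoʳ (⊗-monoˡ x∧y≤y) ⟩
      p ⊗ ((¬ t ⇒ s) ⊗ ¬ t) ≤⟨ ⊗-monoʳ modus-ponens ⟩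
      p ⊗ s                ∎

  ⊗-⊕-subdistrib : ∀ p q s t → (p ⊗ q) ⊗ (s ⊕ t) ≤ (p ⊗ s) ⊕ (q ⊗ t)
  ⊗-⊕-subdistrib p q s t = begin
    (p ⊗ q) ⊗ (s ⊕ t)    ≡⟨ ⊗-rotate p q (s ⊕ t) ⟩
    q ⊗ (p ⊗ (s ⊕ t))    ≤⟨ ⊗-monoʳ (⊗-⊕-subdistribˡ p s t) ⟩
    q ⊗ ((p ⊗ s) ⊕ t)    ≡⟨ cong (q ⊗_) (⊕-comm (p ⊗ s) t) ⟩
    q ⊗ (t ⊕ (p ⊗ s))    ≤⟨ ⊗-⊕-subdistribˡ q t (p ⊗ s) ⟩
    (q ⊗ t) ⊕ (p ⊗ s)    ≡⟨ ⊕-comm (q ⊗ t) (p ⊗ s) ⟩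
    (p ⊗ s) ⊕ (q ⊗ t)    ∎

  -- Powers, finite meets and partitions of unity

  infixl 9 _^_
  _^_ : Carrier → ℕ → Carrier
  x ^ zero  = 𝟙
  x ^ suc n = x ⊗ x ^ n

  𝟙^n≡𝟙 : ∀ n → 𝟙 ^ n ≡ 𝟙
  𝟙^n≡𝟙 zero    = refl
  𝟙^n≡𝟙 (suc n) = trans (⊗-identityˡ (𝟙 ^ n)) (𝟙^n≡𝟙 n)

  unity-⊗ : ∀ {p q r} → 𝟙 ≤ p ∨ r → 𝟙 ≤ q ∨ r → 𝟙 ≤ (p ⊗ q) ∨ r
  unity-⊗ {p} {q} {r} 𝟙≤p∨r 𝟙≤q∨r = by-cases 𝟙≤p∨r
    (≤-trans x⊗y≤x (by-cases 𝟙≤q∨r (⊗-flip x≤x∨y) (≤-trans x⊗y≤x y≤x∨y)))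
    (≤-trans x⊗y≤x y≤x∨y)

  unity-^ˡ : ∀ {p r} → 𝟙 ≤ p ∨ r → ∀ n → 𝟙 ≤ p ^ n ∨ r
  unity-^ˡ 𝟙≤p∨r zero    = x≤x∨y
  unity-^ˡ 𝟙≤p∨r (suc n) = unity-⊗ 𝟙≤p∨r (unity-^ˡ 𝟙≤p∨r n)

  unity-^ : ∀ {p q} → 𝟙 ≤ p ∨ q → ∀ n → 𝟙 ≤ p ^ n ∨ q ^ n
  unity-^ 𝟙≤p∨q n = unity-comm (unity-^ˡ (unity-comm (unity-^ˡ 𝟙≤p∨q n)) n)

  ⋀ : (ℕ → Carrier) → ℕ → Carrier
  ⋀ e zero    = 𝟙
  ⋀ e (suc n) = e n ∧ ⋀ e n

  unity-⋀ : ∀ {e r} → (∀ j → 𝟙 ≤ e j ∨ r) → ∀ n → 𝟙 ≤ ⋀ e n ∨ r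
  unity-⋀ h zero    = x≤x∨y
  unity-⋀ h (suc n) = ≤-trans (unity-⊗ (h n) (unity-⋀ h n)) (∨-mono ⊗≤∧ ≤-refl)

  ⋀-lower : ∀ {e j n} → j ℕ.<′ n → ⋀ e n ≤ e j
  ⋀-lower ℕ.≤′-refl          = x∧y≤x
  ⋀-lower (ℕ.≤′-step j<′n) = ≤-trans x∧y≤y (⋀-lower j<′n)

  ⋀-lowerBound : ∀ {e} N → (∀ j → N ℕ.≤ j → 𝟙 ≤ e j) → ∀ j → ⋀ e N ≤ e j
  ⋀-lowerBound N top j with j ℕP.<? N
  ... | yes j<N = ⋀-lower (ℕP.<⇒<′ j<N)
  ... | no  j≮N = ≤-trans 𝟙-greatest (top j (ℕP.≮⇒≥ j≮N))

  -- Scaling the sum of sequences: if w ⊗ xⱼ ≤ yⱼ for all j, the i-th term of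
  -- x + c, which involves x₀ … xᵢ, is carried into y + c by wⁱ⁺¹.

  module _ (c : Seq) {w : Carrier} {x y : Seq} (scaled : ∀ j → w ⊗ x j ≤ y j) where

    accumulate : ∀ {W acc acc′} j k → W ⊗ acc ≤ acc′ →
                 (W ⊗ w) ⊗ (acc ⊕ (x j ⊗ c k)) ≤ acc′ ⊕ (y j ⊗ c k)
    accumulate {W} {acc} j k W⊗acc≤acc′ = ≤-trans (⊗-⊕-subdistrib W w acc (x j ⊗ c k))
      (⊕-mono W⊗acc≤acc′ (≤-trans (≤-reflexive (sym (⊗-assoc w (x j) (c k))))
                                    (⊗-monoˡ (scaled j))))

    -- Invariant of the accumulator: j + 1 further x-terms cost w^(j+1).
    go-scaling : ∀ j k {W acc acc′} → W ⊗ acc ≤ acc′ →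
                 (W ⊗ w ^ suc j) ⊗ go x c j k acc ≤ go y c j k acc′
    go-scaling zero k {W} {acc} W⊗acc≤acc′ =
      ≤-trans (≤-reflexive (cong (λ z → (W ⊗ z) ⊗ go x c 0 k acc) (⊗-identityʳ w)))
              (accumulate 0 k W⊗acc≤acc′)
    go-scaling (suc j) k {W} {acc} W⊗acc≤acc′ =
      ≤-trans (≤-reflexive (cong (_⊗ go x c (suc j) k acc) (sym (⊗-assoc W w (w ^ suc j)))))
              (go-scaling j (suc k) (accumulate (suc j) k W⊗acc≤acc′))

    +ˢ-scaling : ∀ i → w ^ suc i ⊗ (x +ˢ c) i ≤ (y +ˢ c) i
    +ˢ-scaling zero = ≤-trans (⊗-⊕-subdistribˡ (w ^ 1) (x 0) (c 0))
      (⊕-mono (≤-trans (⊗-monoˡ x⊗y≤x) (scaled 0)) ≤-refl)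
    +ˢ-scaling (suc n) = ≤-trans (⊗-⊕-subdistribˡ (w ^ suc (suc n)) _ (c (suc n)))
      (⊕-mono (go-scaling n 0 (scaled (suc n))) ≤-refl)

  +ˢ-mono : ∀ c {x y : Seq} → (∀ j → x j ≤ y j) → ∀ i → (x +ˢ c) i ≤ (y +ˢ c) i
  +ˢ-mono c {x} x≤y i = ≤-trans (≤-reflexive 𝟙-scaling)
    (+ˢ-scaling c (λ j → ≤-trans (≤-reflexive (⊗-identityˡ (x j))) (x≤y j)) i)
    where
    𝟙-scaling : (x +ˢ c) i ≡ 𝟙 ^ suc i ⊗ (x +ˢ c) i
    𝟙-scaling = sym (trans (cong (_⊗ (x +ˢ c) i) (𝟙^n≡𝟙 (suc i))) (⊗-identityˡ _))

  -- Sequences that are comparable along a partition of unity 1 ≤ u ∨ v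
  -- (in a BL-chain this means a ≤ b or b ≤ a); for them the sum with any c
  -- distributes over ∨ and ∧.

  record Comparable (a b : Seq) : Set ℓ where
    field
      u v      : Carrier
      unity    : 𝟙 ≤ u ∨ v
      u-scales : ∀ j → u ⊗ a j ≤ b j
      v-scales : ∀ j → v ⊗ b j ≤ a j

  module _ {a b : Seq} (comparable : Comparable a b) (c : Seq) where
    open Comparable comparable

    +ˢ-distrib-∨ : ∀ i → ((a ∨ˢ b) +ˢ c) i ≡ ((a +ˢ c) ∨ˢ (b +ˢ c)) i
    +ˢ-distrib-∨ i = ≤-antisym
      (by-cases (unity-^ unity (suc i))
        (≤-trans (+ˢ-scaling c (λ j → ⊗-∨-bounded (u-scales j) x⊗y≤y) i) y≤x∨y)
        (≤-trans (+ˢ-scaling c (λ j → ⊗-∨-bounded x⊗y≤y (v-scales j)) i) x≤x∨y))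
      (∨-lub (+ˢ-mono c (λ _ → x≤x∨y) i) (+ˢ-mono c (λ _ → y≤x∨y) i))

    +ˢ-distrib-∧ : ∀ i → ((a ∧ˢ b) +ˢ c) i ≡ ((a +ˢ c) ∧ˢ (b +ˢ c)) i
    +ˢ-distrib-∧ i = ≤-antisym
      (∧-glb (+ˢ-mono c (λ _ → x∧y≤x) i) (+ˢ-mono c (λ _ → x∧y≤y) i))
      (by-cases (unity-^ unity (suc i))
        (≤-trans (⊗-monoʳ x∧y≤x) (+ˢ-scaling c (λ j → ∧-glb x⊗y≤y (u-scales j)) i))
        (≤-trans (⊗-monoʳ x∧y≤y) (+ˢ-scaling c (λ j → ∧-glb (v-scales j) x⊗y≤y) i)))

  -- Good sequences are comparable

  module GoodSequence {a : Seq} (good-a : IsGood a) where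
    open IsGood good-a

    support : ℕ
    support = proj₁ eventually-zero

    vanishes : ∀ {i} → support ℕ.≤ i → a i ≡ 𝟘
    vanishes = proj₂ eventually-zero _

    antitone : ∀ {m n} → m ℕ.≤′ n → a n ≤ a m
    antitone ℕ.≤′-refl        = ≤-refl
    antitone (ℕ.≤′-step m≤′n) = ≤-trans (GoodPair.y≤x (good _)) (antitone m≤′n)

    unity-gap : ∀ {j k} → j ℕ.< k → 𝟙 ≤ a j ∨ ¬ a k
    unity-gap {j} j<k =
      ≤-trans (GoodPair.unity (good j)) (∨-mono ≤-refl (¬-antitone (antitone (ℕP.≤⇒≤′ j<k))))

  cross-prelinearity : ∀ {a b} → IsGood a → IsGood b →
                       ∀ j k → 𝟙 ≤ (a j ⇒ b j) ∨ (b k ⇒ a k)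
  cross-prelinearity {a} {b} good-a good-b j k with ℕP.<-cmp j k
  ... | tri< j<k _ _ =
    ≤-trans (GoodSequence.unity-gap good-b j<k) (∨-mono y≤x⇒y ¬x≤x⇒y)
  ... | tri≈ _ refl _ = prelinear (a j) (b j)
  ... | tri> _ _ k<j =
    unity-comm (≤-trans (GoodSequence.unity-gap good-a k<j) (∨-mono y≤x⇒y ¬x≤x⇒y))

  -- u and v are the meets of aⱼ ⇒ bⱼ resp. bⱼ ⇒ aⱼ below the common support;
  -- beyond it these implications are 1.
  good⇒comparable : ∀ {a b} → IsGood a → IsGood b → Comparable a b
  good⇒comparable {a} {b} good-a good-b = record
    { u = ⋀ (λ j → a j ⇒ b j) N
    ; v = ⋀ (λ j → b j ⇒ a j) N
    ; unity = unity-⋀ (λ j → unity-comm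
                (unity-⋀ (λ k → unity-comm (cross-prelinearity good-a good-b j k)) N)) N
    ; u-scales = λ j → uncurry (⋀-lowerBound N (λ i N≤i →
                   ≡𝟘⇒top (A.vanishes (ℕP.≤-trans (ℕP.m≤m⊔n A.support B.support) N≤i))) j)
    ; v-scales = λ j → uncurry (⋀-lowerBound N (λ i N≤i →
                   ≡𝟘⇒top (B.vanishes (ℕP.≤-trans (ℕP.m≤n⊔m A.support B.support) N≤i))) j)
    }
    where
    module A = GoodSequence good-a
    module B = GoodSequence good-b
    N : ℕ
    N = A.support ℕ.⊔ B.support

-- Proposition 5.2

proposition5p2 : ∀ {ℓ : Level} (L : BLAlgebra ℓ) → let open BLAlgebra L in
    (a b c : Seq) → IsGood a → IsGood b → IsGood c →
    (∀ i → ((a ∨ˢ b) +ˢ c) i ≡ ((a +ˢ c) ∨ˢ (b +ˢ c)) i) ×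
    (∀ i → ((a ∧ˢ b) +ˢ c) i ≡ ((a +ˢ c) ∧ˢ (b +ˢ c)) i)
proposition5p2 L a b c good-a good-b _ =
  +ˢ-distrib-∨ comparable c , +ˢ-distrib-∧ comparable c
  where
  open BLTheory L
  comparable : Comparable a b
  comparable = good⇒comparable good-a good-b
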